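{- Let $\gamma\in(0,1)$, let $n\ge1$, and let $X\in\{0,1\}^{n^2}$ be a fixed (vectorized) dataset. Call $Y\in\{0,1\}^{n^2}$ bad if $\|X-Y\|_1>\gamma n^2$. A set of queries $\{Q_1,\dots,Q_k\}\subseteq\{ -1,1\}^{n^2}$ catches a dataset $Y$ if more than $\frac{\gamma^2k}{32}$ of the values $|Q_1\cdot(X-Y)|,\dots,|Q_k\cdot(X-Y)|$ exceed $\frac{\sqrt\gamma n}{2}$. Suppose $k=\frac{128n^2}{\gamma^2}$ and $Q_1,\dots,Q_k$ are independent uniformly random outer-product queries. Then the probability that there exists a bad dataset not caught by $\{Q_1,\dots,Q_k\}$ is at most $\frac16$.
   Context: An outer-product query is specified by $A,B\in\{ -1,1\}^n$ chosen independently and uniformly at random; its vector representation $Q\in\{ -1,1\}^{n^2}$ is the vectorization of the outer product $A\otimes B$ (i.e. $Q_{(i,j)}=A_iB_j$), so that for a vectorized $n\times n$ matrix $X$, $Q\cdot X=A^TXB$. $\|\cdot\|_1$ on $\{0,1\}^{n^2}$ differences is the Hamming distance. -}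

module Defs where

open import Data.Bool using (Bool; true; false)
open import Data.Nat as ℕ using (ℕ; zero; suc)
open import Data.Integer as ℤ using (ℤ; +_; -_)
open import Data.Fin using (Fin; zero; suc)
open import Data.Fin.Subset using (Subset; _∈_; ∣_∣)
open import Data.Vec using (Vec; lookup)
open import Data.Product using (_×_; ∃; Σ; proj₁; proj₂; _,_)
open import Data.List using (List; length)
open import Data.List.Membership.Propositional using () renaming (_∈_ to _∈ₗ_)
open import Relation.Nullary using (¬_)

sumFin : ∀ n → (Fin n → ℤ) → ℤ
sumFin zero    f = + 0
sumFin (suc n) f = f zero ℤ.+ sumFin n (λ i → f (suc i))

Dataset : ℕ → Set
Dataset n = Fin n → Fin n → Bool

bit : Bool → ℤ
bit true  = + 1
bit false = + 0

sgn : Bool → ℤ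
sgn true  = + 1
sgn false = - (+ 1)

-- an outer-product query, given by (A , B) ∈ {-1,1}^n × {-1,1}^n
OPQuery : ℕ → Set
OPQuery n = Vec Bool n × Vec Bool n

Queries : ℕ → ℕ → Set
Queries n k = Vec (OPQuery n) k

hamming : ∀ {n} → Dataset n → Dataset n → ℤ
hamming {n} X Y = sumFin n λ i → sumFin n λ j → + ℤ.∣ bit (X i j) ℤ.- bit (Y i j) ∣

-- Q · (X - Y) = A^T (X - Y) B  where Q = vec(A ⊗ B)
dotDiff : ∀ {n} → OPQuery n → Dataset n → Dataset n → ℤ
dotDiff {n} (A , B) X Y =
  sumFin n λ i → sumFin n λ j →
    sgn (lookup A i) ℤ.* sgn (lookup B j) ℤ.* (bit (X i j) ℤ.- bit (Y i j))

-- Parametrisation: γ ∈ (0,1) real with k = 128 n² / γ², i.e. γ² = 128 n² / k.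
-- Then γ ∈ (0,1) ⇔ 128 n² < k, and (all quantities nonnegative):
--   ‖X-Y‖₁ > γ n²              ⇔  k ‖X-Y‖₁² > 128 n⁶
--   |Q·(X-Y)| > √γ n / 2       ⇔  k (Q·(X-Y))⁴ > 8 n⁶
--   (#exceeding) > γ² k / 32   ⇔  (#exceeding) > 4 n²

Bad : ∀ n (k : ℕ) → Dataset n → Dataset n → Set
Bad n k X Y = + (128 ℕ.* n ℕ.^ 6) ℤ.< + k ℤ.* (hamming X Y ℤ.^ 2)

Exceeds : ∀ n (k : ℕ) → Dataset n → Dataset n → OPQuery n → Set
Exceeds n k X Y Q = + (8 ℕ.* n ℕ.^ 6) ℤ.< + k ℤ.* (dotDiff Q X Y ℤ.^ 4)

Catches : ∀ n k → Dataset n → Queries n k → Dataset n → Set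
Catches n k X qs Y =
  Σ (Subset k) λ S → (4 ℕ.* n ℕ.^ 2 ℕ.< ∣ S ∣) × (∀ t → t ∈ S → Exceeds n k X Y (lookup qs t))

Fails : ∀ n k → Dataset n → Queries n k → Set
Fails n k X qs = ∃ λ (Y : Dataset n) → Bad n k X Y × ¬ Catches n k X qs Y

-- Pr_{qs uniform}[ E ] ≤ 1/6, where the sample space Queries n k has 2^(2nk)
-- equally likely outcomes: the event is covered by a list of ≤ 2^(2nk)/6 outcomes.
ProbAtMostSixth : ∀ n k → (Queries n k → Set) → Set
ProbAtMostSixth n k E =
  ∃ λ (L : List (Queries n k)) →
    (∀ qs → E qs → qs ∈ₗ L) × (6 ℕ.* length L ℕ.≤ 2 ℕ.^ (2 ℕ.* n ℕ.* k))

-- Let D = X − Y, so that a query (A , B) sees AᵀDB and ‖X − Y‖₁ = ‖D‖².  For uniform signs,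
-- Σ (AᵀDB)² = 4ⁿ‖D‖² exactly, and applying the Khintchine-type bound Σ_A ⟨A,u⟩²⟨A,v⟩² ≤ 3·2ⁿ|u|²|v|²
-- first in B and then in A gives Σ (AᵀDB)⁴ ≤ 9·4ⁿ‖D‖⁴.  Paley–Zygmund then makes at least 1/16 of
-- the 4ⁿ queries good, (AᵀDB)² ≥ ‖D‖²/4, and when D is bad every good query exceeds the threshold.
-- Weighting each k-tuple of queries by 2^(number of non-good entries) shows that at most
-- 2^(4n²)·(31/32)^k·4^(nk) tuples have at most 4n² good entries.  A union bound over the 2^(n²)
-- datasets leaves the inequality 6·32^(n²)·31^k ≤ 32^k, which holds for k > 128n² once n ≥ 2;
-- for n = 1 every query is good.

module Submission where

open import Defs
open import Algebra.Bundles using (CommutativeSemiring)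
open import Data.Bool using (Bool; true; false)
open import Data.Fin using (Fin; zero; suc)
open import Data.List using (List; []; _∷_; _++_; map; concatMap; length; filter; cartesianProductWith; cartesianProduct)
import Data.List.Properties as List
open import Data.List.Membership.Propositional using () renaming (_∈_ to _∈ₗ_)
open import Data.List.Membership.Propositional.Properties
  using (∈-cartesianProductWith⁺; ∈-cartesianProduct⁺; ∈-filter⁺; ∈-map⁺; ∈-concat⁺′)
open import Data.List.Relation.Unary.Any using (here; there)
import Data.Nat as ℕ
import Data.Nat.Properties as ℕ
open import Data.Nat using (ℕ)
open import Data.Product using (_,_)
import Data.Integer as ℤ
import Data.Integer.Properties as ℤ
open import Data.Integer using (ℤ)
open import Data.Vec using (Vec; []; _∷_; lookup; tabulate)
import Data.Vec.Properties as Vec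
open import Function using (_∘_)
open import Relation.Unary using (Decidable)
open import Relation.Nullary using (does; yes; no; ¬_; contradiction)
open import Relation.Binary.PropositionalEquality using (_≡_)
import Relation.Binary.PropositionalEquality as ≡

module _ {A B C : Set} (f : A → B → C) where

  length-cartesianProductWith : ∀ (xs : List A) ys →
    length (cartesianProductWith f xs ys) ≡ length xs ℕ.* length ys
  length-cartesianProductWith []       ys = ≡.refl
  length-cartesianProductWith (x ∷ xs) ys = ≡.trans (List.length-++ (map (f x) ys))
    (≡.cong₂ ℕ._+_ (List.length-map (f x) ys) (length-cartesianProductWith xs ys))

vecsOver : ∀ {A : Set} → List A → ∀ n → List (Vec A n)
vecsOver Ω ℕ.zero    = [] ∷ []
vecsOver Ω (ℕ.suc n) = cartesianProductWith _∷_ Ω (vecsOver Ω n)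

module _ {A : Set} (Ω : List A) where

  length-vecsOver : ∀ n → length (vecsOver Ω n) ≡ length Ω ℕ.^ n
  length-vecsOver ℕ.zero    = ≡.refl
  length-vecsOver (ℕ.suc n) = ≡.trans (length-cartesianProductWith _∷_ Ω (vecsOver Ω n))
    (≡.cong (length Ω ℕ.*_) (length-vecsOver n))

  ∈-vecsOver : (∀ a → a ∈ₗ Ω) → ∀ {n} (v : Vec A n) → v ∈ₗ vecsOver Ω n
  ∈-vecsOver ∈Ω []      = here ≡.refl
  ∈-vecsOver ∈Ω (a ∷ v) = ∈-cartesianProductWith⁺ _∷_ (∈Ω a) (∈-vecsOver ∈Ω v)

cube : ∀ n → List (Vec Bool n)
cube = vecsOver (true ∷ false ∷ [])

length-cube : ∀ n → length (cube n) ≡ 2 ℕ.^ n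
length-cube = length-vecsOver (true ∷ false ∷ [])

∈-cube : ∀ {n} (A : Vec Bool n) → A ∈ₗ cube n
∈-cube = ∈-vecsOver (true ∷ false ∷ []) λ where
  true  → here ≡.refl
  false → there (here ≡.refl)

module ListSum {c ℓ} (R : CommutativeSemiring c ℓ) where
  open CommutativeSemiring R
  open import Algebra.Properties.CommutativeSemigroup +-commutativeSemigroup using (interchange)
  open import Relation.Binary.Reasoning.Setoid setoid

  ∑ : {A : Set} → List A → (A → Carrier) → Carrier
  ∑ []       f = 0#
  ∑ (x ∷ xs) f = f x + ∑ xs f

  syntax ∑ xs (λ x → e) = ∑[ x ← xs ] e

  module _ {A : Set} where

    ∑-cong : ∀ (xs : List A) {f g} → (∀ x → f x ≈ g x) → ∑ xs f ≈ ∑ xs g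
    ∑-cong []       f≈g = refl
    ∑-cong (x ∷ xs) f≈g = +-cong (f≈g x) (∑-cong xs f≈g)

    ∑-++ : ∀ (xs ys : List A) f → ∑ (xs ++ ys) f ≈ ∑ xs f + ∑ ys f
    ∑-++ []       ys f = sym (+-identityˡ _)
    ∑-++ (x ∷ xs) ys f = trans (+-congˡ (∑-++ xs ys f)) (sym (+-assoc _ _ _))

    ∑-distrib-+ : ∀ (xs : List A) f g → ∑[ x ← xs ] (f x + g x) ≈ ∑ xs f + ∑ xs g
    ∑-distrib-+ []       f g = sym (+-identityˡ 0#)
    ∑-distrib-+ (x ∷ xs) f g = trans (+-congˡ (∑-distrib-+ xs f g)) (interchange _ _ _ _)

    *-distribˡ-∑ : ∀ (xs : List A) a f → a * ∑ xs f ≈ ∑[ x ← xs ] (a * f x)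
    *-distribˡ-∑ []       a f = zeroʳ a
    *-distribˡ-∑ (x ∷ xs) a f = trans (distribˡ a (f x) _) (+-congˡ (*-distribˡ-∑ xs a f))

    *-distribʳ-∑ : ∀ (xs : List A) a f → ∑ xs f * a ≈ ∑[ x ← xs ] (f x * a)
    *-distribʳ-∑ []       a f = zeroˡ a
    *-distribʳ-∑ (x ∷ xs) a f = trans (distribʳ a (f x) _) (+-congˡ (*-distribʳ-∑ xs a f))

  ∑-map : ∀ {A B : Set} (g : A → B) (xs : List A) f → ∑ (map g xs) f ≡ ∑ xs (f ∘ g)
  ∑-map g []       f = ≡.refl
  ∑-map g (x ∷ xs) f = ≡.cong (f (g x) +_) (∑-map g xs f)

  ∑-cartesianProductWith : ∀ {A B C : Set} (h : A → B → C) (xs : List A) ys f →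
    ∑ (cartesianProductWith h xs ys) f ≈ ∑[ x ← xs ] ∑[ y ← ys ] f (h x y)
  ∑-cartesianProductWith h []       ys f = refl
  ∑-cartesianProductWith h (x ∷ xs) ys f = begin
    ∑ (map (h x) ys ++ cartesianProductWith h xs ys) f
      ≈⟨ ∑-++ (map (h x) ys) _ f ⟩
    ∑ (map (h x) ys) f + ∑ (cartesianProductWith h xs ys) f
      ≈⟨ +-cong (reflexive (∑-map (h x) ys f)) (∑-cartesianProductWith h xs ys f) ⟩
    ∑[ y ← ys ] f (h x y) + ∑[ x′ ← xs ] ∑[ y ← ys ] f (h x′ y) ∎


module ℤ∑ = ListSum ℤ.+-*-commutativeSemiring
module ℕ∑ = ListSum ℕ.+-*-commutativeSemiring

module IntegerSums where
  open import Algebra.Properties.CommutativeSemigroup ℤ.+-commutativeSemigroup using (interchange)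
  open import Data.Integer using (+_; 0ℤ; _+_; _*_; _≤_; +≤+)
  open ≡ using (refl; sym; trans; cong; cong₂; subst)
  open ℤ∑

  0≤i*i : ∀ i → 0ℤ ≤ i * i
  0≤i*i (+ n)     = subst (0ℤ ≤_) (ℤ.pos-* n n) (+≤+ ℕ.z≤n)
  0≤i*i ℤ.-[1+ n ] = +≤+ ℕ.z≤n

  0≤i*j : ∀ {i j} → 0ℤ ≤ i → 0ℤ ≤ j → 0ℤ ≤ i * j
  0≤i*j {i} {j} 0≤i 0≤j = subst (_≤ i * j) (ℤ.*-zeroʳ i) (ℤ.*-monoˡ-≤-nonNeg i {{ℤ.nonNegative 0≤i}} 0≤j)

  module _ {A : Set} where

    ∑-mono-≤ : ∀ (xs : List A) {f g} → (∀ x → f x ≤ g x) → ∑ xs f ≤ ∑ xs g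
    ∑-mono-≤ []       f≤g = ℤ.≤-refl
    ∑-mono-≤ (x ∷ xs) f≤g = ℤ.+-mono-≤ (f≤g x) (∑-mono-≤ xs f≤g)

    ∑-nonNeg : ∀ (xs : List A) {f} → (∀ x → 0ℤ ≤ f x) → 0ℤ ≤ ∑ xs f
    ∑-nonNeg []       0≤f = ℤ.≤-refl
    ∑-nonNeg (x ∷ xs) 0≤f = ℤ.+-mono-≤ (0≤f x) (∑-nonNeg xs 0≤f)

    ∑-const : ∀ (xs : List A) c → ∑[ _ ← xs ] c ≡ + length xs * c
    ∑-const []       c = sym (ℤ.*-zeroˡ c)
    ∑-const (x ∷ xs) c = trans (cong (_+_ c) (∑-const xs c)) (sym (ℤ.suc-* (+ length xs) c))

  sumFin-cong : ∀ n {f g : Fin n → ℤ} → (∀ i → f i ≡ g i) → sumFin n f ≡ sumFin n g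
  sumFin-cong ℕ.zero    f≡g = refl
  sumFin-cong (ℕ.suc n) f≡g = cong₂ _+_ (f≡g zero) (sumFin-cong n (f≡g ∘ suc))

  sumFin-mono-≤ : ∀ n {f g : Fin n → ℤ} → (∀ i → f i ≤ g i) → sumFin n f ≤ sumFin n g
  sumFin-mono-≤ ℕ.zero    f≤g = ℤ.≤-refl
  sumFin-mono-≤ (ℕ.suc n) f≤g = ℤ.+-mono-≤ (f≤g zero) (sumFin-mono-≤ n (f≤g ∘ suc))

  sumFin-nonNeg : ∀ n {f : Fin n → ℤ} → (∀ i → 0ℤ ≤ f i) → 0ℤ ≤ sumFin n f
  sumFin-nonNeg ℕ.zero    0≤f = ℤ.≤-refl
  sumFin-nonNeg (ℕ.suc n) 0≤f = ℤ.+-mono-≤ (0≤f zero) (sumFin-nonNeg n (0≤f ∘ suc))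

  sumFin-distrib-+ : ∀ n (f g : Fin n → ℤ) → sumFin n (λ i → f i + g i) ≡ sumFin n f + sumFin n g
  sumFin-distrib-+ ℕ.zero    f g = refl
  sumFin-distrib-+ (ℕ.suc n) f g =
    trans (cong (_+_ (f zero + g zero)) (sumFin-distrib-+ n (f ∘ suc) (g ∘ suc))) (interchange (f zero) (g zero) _ _)

  *-distribˡ-sumFin : ∀ n a (f : Fin n → ℤ) → a * sumFin n f ≡ sumFin n (λ i → a * f i)
  *-distribˡ-sumFin ℕ.zero    a f = ℤ.*-zeroʳ a
  *-distribˡ-sumFin (ℕ.suc n) a f = trans (ℤ.*-distribˡ-+ a (f zero) _) (cong (_+_ (a * f zero)) (*-distribˡ-sumFin n a (f ∘ suc)))

  sumFin-zero : ∀ n → sumFin n (λ _ → 0ℤ) ≡ 0ℤ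
  sumFin-zero ℕ.zero    = refl
  sumFin-zero (ℕ.suc n) = trans (ℤ.+-identityˡ _) (sumFin-zero n)

  sumFin-comm : ∀ m n (f : Fin m → Fin n → ℤ) →
    sumFin m (λ i → sumFin n (f i)) ≡ sumFin n (λ j → sumFin m (λ i → f i j))
  sumFin-comm ℕ.zero    n f = sym (sumFin-zero n)
  sumFin-comm (ℕ.suc m) n f = trans (cong (_+_ (sumFin n (f zero))) (sumFin-comm m n (f ∘ suc)))
    (sym (sumFin-distrib-+ n (f zero) _))

  ∑-sumFin-comm : ∀ {A : Set} (xs : List A) n (f : A → Fin n → ℤ) →
    ∑[ x ← xs ] sumFin n (f x) ≡ sumFin n (λ i → ∑[ x ← xs ] f x i)
  ∑-sumFin-comm []       n f = sym (sumFin-zero n)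
  ∑-sumFin-comm (x ∷ xs) n f = trans (cong (_+_ (sumFin n (f x))) (∑-sumFin-comm xs n f))
    (sym (sumFin-distrib-+ n (f x) _))

  i+k≡j⇒i≤j : ∀ {i j k} → 0ℤ ≤ k → i + k ≡ j → i ≤ j
  i+k≡j⇒i≤j {i} {k = k} 0≤k eq = subst (i ≤_) eq (ℤ.i≤i+j i k {{ℤ.nonNegative 0≤k}})

  sumFin-*-sumFin : ∀ m n (f : Fin m → ℤ) (g : Fin n → ℤ) →
    sumFin m f * sumFin n g ≡ sumFin m (λ i → sumFin n (λ j → f i * g j))
  sumFin-*-sumFin m n f g = trans (ℤ.*-comm (sumFin m f) _)
    (trans (*-distribˡ-sumFin m (sumFin n g) f)
           (sumFin-cong m (λ i → trans (ℤ.*-comm (sumFin n g) (f i)) (*-distribˡ-sumFin n (f i) g))))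

module SignedSums where
  open import Data.Integer using (+_; -_; 0ℤ; _+_; _-_; _*_; _≤_; +≤+)
  open import Data.Integer.Tactic.RingSolver using (solve-∀)
  open ≡ using (refl; sym; trans; cong; cong₂; subst)
  open ℤ∑
  open IntegerSums

  ∑-cube-suc : ∀ n (f : Vec Bool (ℕ.suc n) → ℤ) →
    ∑ (cube (ℕ.suc n)) f ≡ ∑[ A ← cube n ] (f (true ∷ A) + f (false ∷ A))
  ∑-cube-suc n f = trans (∑-cartesianProductWith _∷_ (true ∷ false ∷ []) (cube n) f)
    (trans (cong (_+_ (∑[ A ← cube n ] f (true ∷ A))) (ℤ.+-identityʳ _))
           (sym (∑-distrib-+ (cube n) _ _)))

  signs : ∀ {n} → Vec Bool n → Fin n → ℤ
  signs A i = sgn (lookup A i)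

  ⟨_,_⟩ : ∀ {n} → (Fin n → ℤ) → (Fin n → ℤ) → ℤ
  ⟨_,_⟩ {n} u v = sumFin n (λ i → u i * v i)

  signed-secondMoment : ∀ n (u v : Fin n → ℤ) →
    ∑[ A ← cube n ] (⟨ signs A , u ⟩ * ⟨ signs A , v ⟩) ≡ + (2 ℕ.^ n) * ⟨ u , v ⟩
  signed-secondMoment ℕ.zero    u v = refl
  signed-secondMoment (ℕ.suc n) u v = begin
    ∑ (cube (ℕ.suc n)) (λ A → ⟨ signs A , u ⟩ * ⟨ signs A , v ⟩)
      ≡⟨ ∑-cube-suc n _ ⟩
    ∑[ A ← cube n ] ((+ 1 * a + x A) * (+ 1 * b + y A) + (- + 1 * a + x A) * (- + 1 * b + y A))
      ≡⟨ ∑-cong (cube n) (λ A → two-point a b (x A) (y A)) ⟩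
    ∑[ A ← cube n ] (+ 2 * (a * b) + + 2 * (x A * y A))
      ≡⟨ ∑-distrib-+ (cube n) _ _ ⟩
    ∑[ _ ← cube n ] (+ 2 * (a * b)) + ∑[ A ← cube n ] (+ 2 * (x A * y A))
      ≡⟨ cong₂ _+_ (∑-const (cube n) _) (sym (*-distribˡ-∑ (cube n) (+ 2) _)) ⟩
    + length (cube n) * (+ 2 * (a * b)) + + 2 * ∑[ A ← cube n ] (x A * y A)
      ≡⟨ cong₂ (λ l s → + l * (+ 2 * (a * b)) + + 2 * s) (length-cube n) (signed-secondMoment n (u ∘ suc) (v ∘ suc)) ⟩
    + (2 ℕ.^ n) * (+ 2 * (a * b)) + + 2 * (+ (2 ℕ.^ n) * ⟨ u ∘ suc , v ∘ suc ⟩)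
      ≡⟨ regroup (+ (2 ℕ.^ n)) (a * b) _ ⟩
    + 2 * + (2 ℕ.^ n) * (a * b + ⟨ u ∘ suc , v ∘ suc ⟩)
      ≡⟨ cong (_* (a * b + ⟨ u ∘ suc , v ∘ suc ⟩)) (sym (ℤ.pos-* 2 (2 ℕ.^ n))) ⟩
    + (2 ℕ.^ ℕ.suc n) * ⟨ u , v ⟩ ∎
    where
    a = u zero
    b = v zero
    x y : Vec Bool n → ℤ
    x A = ⟨ signs A , u ∘ suc ⟩
    y A = ⟨ signs A , v ∘ suc ⟩
    two-point : ∀ a b x y →
      (+ 1 * a + x) * (+ 1 * b + y) + (- + 1 * a + x) * (- + 1 * b + y) ≡ + 2 * (a * b) + + 2 * (x * y)
    two-point = solve-∀
    regroup : ∀ p c d → p * (+ 2 * c) + + 2 * (p * d) ≡ + 2 * p * (c + d)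
    regroup = solve-∀
    open ≡.≡-Reasoning

  lagrange-identity : ∀ n a b (u v : Fin n → ℤ) →
    ⟨ (λ i → a * v i - b * u i) , (λ i → a * v i - b * u i) ⟩
      ≡ a * a * ⟨ v , v ⟩ + b * b * ⟨ u , u ⟩ - + 2 * (a * b) * ⟨ u , v ⟩
  lagrange-identity ℕ.zero    a b u v = empty a b
    where
    empty : ∀ a b → 0ℤ ≡ a * a * 0ℤ + b * b * 0ℤ - + 2 * (a * b) * 0ℤ
    empty = solve-∀
  lagrange-identity (ℕ.suc n) a b u v =
    trans (cong (_+_ ((a * v zero - b * u zero) * (a * v zero - b * u zero)))
                (lagrange-identity n a b (u ∘ suc) (v ∘ suc)))
          (step a b (u zero) (v zero) _ _ _)
    where
    step : ∀ a b u₀ v₀ V U W →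
      (a * v₀ - b * u₀) * (a * v₀ - b * u₀) + (a * a * V + b * b * U - + 2 * (a * b) * W)
        ≡ a * a * (v₀ * v₀ + V) + b * b * (u₀ * u₀ + U) - + 2 * (a * b) * (u₀ * v₀ + W)
    step = solve-∀

  ∑-cube-suc-shifted : ∀ n (u v : Fin (ℕ.suc n) → ℤ) α β →
    ∑[ A ← cube (ℕ.suc n) ] ((α + ⟨ signs A , u ⟩ * ⟨ signs A , u ⟩) * (β + ⟨ signs A , v ⟩ * ⟨ signs A , v ⟩))
      ≡ + 2 * ∑[ A ← cube n ] ((α + u zero * u zero + ⟨ signs A , u ∘ suc ⟩ * ⟨ signs A , u ∘ suc ⟩)
                              * (β + v zero * v zero + ⟨ signs A , v ∘ suc ⟩ * ⟨ signs A , v ∘ suc ⟩))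
        + + 8 * (u zero * v zero) * (+ (2 ℕ.^ n) * ⟨ u ∘ suc , v ∘ suc ⟩)
  ∑-cube-suc-shifted n u v α β = begin
    ∑ (cube (ℕ.suc n)) (λ A → (α + ⟨ signs A , u ⟩ * ⟨ signs A , u ⟩) * (β + ⟨ signs A , v ⟩ * ⟨ signs A , v ⟩))
      ≡⟨ ∑-cube-suc n _ ⟩
    ∑[ A ← cube n ] ((α + (+ 1 * a + x A) * (+ 1 * a + x A)) * (β + (+ 1 * b + y A) * (+ 1 * b + y A))
                   + (α + (- + 1 * a + x A) * (- + 1 * a + x A)) * (β + (- + 1 * b + y A) * (- + 1 * b + y A)))
      ≡⟨ ∑-cong (cube n) (λ A → two-point α β a b (x A) (y A)) ⟩
    ∑[ A ← cube n ] (+ 2 * F A + + 8 * (a * b) * (x A * y A))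
      ≡⟨ ∑-distrib-+ (cube n) _ _ ⟩
    ∑[ A ← cube n ] (+ 2 * F A) + ∑[ A ← cube n ] (+ 8 * (a * b) * (x A * y A))
      ≡⟨ cong₂ _+_ (sym (*-distribˡ-∑ (cube n) (+ 2) F)) (sym (*-distribˡ-∑ (cube n) (+ 8 * (a * b)) _)) ⟩
    + 2 * ∑ (cube n) F + + 8 * (a * b) * ∑[ A ← cube n ] (x A * y A)
      ≡⟨ cong (λ s → + 2 * ∑ (cube n) F + + 8 * (a * b) * s) (signed-secondMoment n (u ∘ suc) (v ∘ suc)) ⟩
    + 2 * ∑ (cube n) F + + 8 * (a * b) * (+ (2 ℕ.^ n) * ⟨ u ∘ suc , v ∘ suc ⟩) ∎
    where
    open ≡.≡-Reasoning
    a = u zero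
    b = v zero
    x y : Vec Bool n → ℤ
    x A = ⟨ signs A , u ∘ suc ⟩
    y A = ⟨ signs A , v ∘ suc ⟩
    F : Vec Bool n → ℤ
    F A = (α + a * a + x A * x A) * (β + b * b + y A * y A)
    two-point : ∀ α β a b x y →
      (α + (+ 1 * a + x) * (+ 1 * a + x)) * (β + (+ 1 * b + y) * (+ 1 * b + y))
        + (α + (- + 1 * a + x) * (- + 1 * a + x)) * (β + (- + 1 * b + y) * (- + 1 * b + y))
      ≡ + 2 * ((α + a * a + x * x) * (β + b * b + y * y)) + + 8 * (a * b) * (x * y)
    two-point = solve-∀

  absorb-cross-term : ∀ {P} α β a b U V W → 0ℤ ≤ P → 0ℤ ≤ a * a * V + b * b * U - + 2 * (a * b) * W →
    + 2 * (P * ((α + a * a) * (β + b * b) + (α + a * a) * V + (β + b * b) * U + + 3 * (U * V)))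
      + + 8 * (a * b) * (P * W)
    ≤ + 2 * P * (α * β + α * (b * b + V) + β * (a * a + U) + + 3 * ((a * a + U) * (b * b + V)))
  absorb-cross-term {P} α β a b U V W 0≤P 0≤lagrange =
    i+k≡j⇒i≤j (ℤ.+-mono-≤ (0≤i*j 0≤4P (0≤i*j (0≤i*i a) (0≤i*i b))) (0≤i*j 0≤4P 0≤lagrange))
              (slack P α β a b U V W)
    where
    0≤4P : 0ℤ ≤ + 4 * P
    0≤4P = 0≤i*j {+ 4} (+≤+ ℕ.z≤n) 0≤P
    slack : ∀ P α β a b U V W →
      + 2 * (P * ((α + a * a) * (β + b * b) + (α + a * a) * V + (β + b * b) * U + + 3 * (U * V)))
        + + 8 * (a * b) * (P * W)
        + (+ 4 * P * (a * a * (b * b)) + + 4 * P * (a * a * V + b * b * U - + 2 * (a * b) * W))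
      ≡ + 2 * P * (α * β + α * (b * b + V) + β * (a * a + U) + + 3 * ((a * a + U) * (b * b + V)))
    slack = solve-∀

  -- The shifts α, β load the induction: splitting off the first coordinate turns them into α + u₀², β + v₀².
  signed-shiftedFourthMoment-≤ : ∀ n (u v : Fin n → ℤ) {α β} → 0ℤ ≤ α → 0ℤ ≤ β →
    ∑[ A ← cube n ] ((α + ⟨ signs A , u ⟩ * ⟨ signs A , u ⟩) * (β + ⟨ signs A , v ⟩ * ⟨ signs A , v ⟩))
      ≤ + (2 ℕ.^ n) * (α * β + α * ⟨ v , v ⟩ + β * ⟨ u , u ⟩ + + 3 * (⟨ u , u ⟩ * ⟨ v , v ⟩))
  signed-shiftedFourthMoment-≤ ℕ.zero    u v {α} {β} _ _ = ℤ.≤-reflexive (empty α β)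
    where
    empty : ∀ α β → (α + 0ℤ * 0ℤ) * (β + 0ℤ * 0ℤ) + 0ℤ ≡ + 1 * (α * β + α * 0ℤ + β * 0ℤ + + 3 * (0ℤ * 0ℤ))
    empty = solve-∀
  signed-shiftedFourthMoment-≤ (ℕ.suc n) u v {α} {β} 0≤α 0≤β = begin
    ∑[ A ← cube (ℕ.suc n) ] ((α + ⟨ signs A , u ⟩ * ⟨ signs A , u ⟩) * (β + ⟨ signs A , v ⟩ * ⟨ signs A , v ⟩))
      ≡⟨ ∑-cube-suc-shifted n u v α β ⟩
    + 2 * ∑[ A ← cube n ] ((α′ + ⟨ signs A , u ∘ suc ⟩ * ⟨ signs A , u ∘ suc ⟩)
                          * (β′ + ⟨ signs A , v ∘ suc ⟩ * ⟨ signs A , v ∘ suc ⟩))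
      + + 8 * (a * b) * (P * W)
      ≤⟨ ℤ.+-monoˡ-≤ _ (ℤ.*-monoˡ-≤-nonNeg (+ 2)
           (signed-shiftedFourthMoment-≤ n (u ∘ suc) (v ∘ suc) 0≤α′ 0≤β′)) ⟩
    + 2 * (P * (α′ * β′ + α′ * V + β′ * U + + 3 * (U * V))) + + 8 * (a * b) * (P * W)
      ≤⟨ absorb-cross-term {P} α β a b U V W (+≤+ ℕ.z≤n) 0≤lagrange ⟩
    + 2 * P * (α * β + α * (b * b + V) + β * (a * a + U) + + 3 * ((a * a + U) * (b * b + V)))
      ≡⟨ cong (_* (α * β + α * (b * b + V) + β * (a * a + U) + + 3 * ((a * a + U) * (b * b + V))))
              (sym (ℤ.pos-* 2 (2 ℕ.^ n))) ⟩
    + (2 ℕ.^ ℕ.suc n) * (α * β + α * ⟨ v , v ⟩ + β * ⟨ u , u ⟩ + + 3 * (⟨ u , u ⟩ * ⟨ v , v ⟩)) ∎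
    where
    open ℤ.≤-Reasoning
    a = u zero
    b = v zero
    α′ = α + a * a
    β′ = β + b * b
    U = ⟨ u ∘ suc , u ∘ suc ⟩
    V = ⟨ v ∘ suc , v ∘ suc ⟩
    W = ⟨ u ∘ suc , v ∘ suc ⟩
    P = + (2 ℕ.^ n)
    0≤α′ : 0ℤ ≤ α′
    0≤α′ = ℤ.+-mono-≤ 0≤α (0≤i*i a)
    0≤β′ : 0ℤ ≤ β′
    0≤β′ = ℤ.+-mono-≤ 0≤β (0≤i*i b)
    0≤lagrange : 0ℤ ≤ a * a * V + b * b * U - + 2 * (a * b) * W
    0≤lagrange = subst (0ℤ ≤_) (lagrange-identity n a b (u ∘ suc) (v ∘ suc))
                       (sumFin-nonNeg n (λ i → 0≤i*i (a * v (suc i) - b * u (suc i))))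

  signed-fourthMoment-≤ : ∀ n (u v : Fin n → ℤ) →
    ∑[ A ← cube n ] (⟨ signs A , u ⟩ * ⟨ signs A , u ⟩ * (⟨ signs A , v ⟩ * ⟨ signs A , v ⟩))
      ≤ + 3 * + (2 ℕ.^ n) * (⟨ u , u ⟩ * ⟨ v , v ⟩)
  signed-fourthMoment-≤ n u v = begin
    ∑[ A ← cube n ] (⟨ signs A , u ⟩ * ⟨ signs A , u ⟩ * (⟨ signs A , v ⟩ * ⟨ signs A , v ⟩))
      ≡⟨ ∑-cong (cube n) (λ A → unshift (⟨ signs A , u ⟩ * ⟨ signs A , u ⟩)
                                        (⟨ signs A , v ⟩ * ⟨ signs A , v ⟩)) ⟩
    ∑[ A ← cube n ] ((0ℤ + ⟨ signs A , u ⟩ * ⟨ signs A , u ⟩) * (0ℤ + ⟨ signs A , v ⟩ * ⟨ signs A , v ⟩))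
      ≤⟨ signed-shiftedFourthMoment-≤ n u v ℤ.≤-refl ℤ.≤-refl ⟩
    + (2 ℕ.^ n) * (0ℤ * 0ℤ + 0ℤ * ⟨ v , v ⟩ + 0ℤ * ⟨ u , u ⟩ + + 3 * (⟨ u , u ⟩ * ⟨ v , v ⟩))
      ≡⟨ unshiftʳ (+ (2 ℕ.^ n)) ⟨ u , u ⟩ ⟨ v , v ⟩ ⟩
    + 3 * + (2 ℕ.^ n) * (⟨ u , u ⟩ * ⟨ v , v ⟩) ∎
    where
    open ℤ.≤-Reasoning
    unshift : ∀ s t → s * t ≡ (0ℤ + s) * (0ℤ + t)
    unshift = solve-∀
    unshiftʳ : ∀ P U V → P * (0ℤ * 0ℤ + 0ℤ * V + 0ℤ * U + + 3 * (U * V)) ≡ + 3 * P * (U * V)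
    unshiftʳ = solve-∀

module BilinearForms where
  open import Data.Integer using (+_; _+_; _*_; _≤_; +≤+)
  open import Data.Integer.Tactic.RingSolver using (solve-∀)
  open ≡ using (sym; trans; cong)
  open ℤ∑
  open IntegerSums
  open SignedSums

  bilinear : ∀ {m n} → Vec Bool m → Vec Bool n → (Fin m → Fin n → ℤ) → ℤ
  bilinear {m} {n} A B M = sumFin m λ i → sumFin n λ j → sgn (lookup A i) * sgn (lookup B j) * M i j

  ‖_‖² : ∀ {m n} → (Fin m → Fin n → ℤ) → ℤ
  ‖_‖² {m} {n} M = sumFin m λ i → sumFin n λ j → M i j * M i j

  column : ∀ {m n} → (Fin m → Fin n → ℤ) → Fin n → Fin m → ℤ
  column M j i = M i j

  module _ {m n} (M : Fin m → Fin n → ℤ) where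

    combineRows : Vec Bool m → Fin n → ℤ
    combineRows A j = ⟨ signs A , column M j ⟩

    bilinear-signed : ∀ A B → bilinear A B M ≡ ⟨ signs B , combineRows A ⟩
    bilinear-signed A B = trans (sumFin-comm m n _) (sumFin-cong n λ j →
      trans (sumFin-cong m (λ i → reassoc (signs A i) (signs B j) (M i j)))
            (sym (*-distribˡ-sumFin m (signs B j) _)))
      where
      reassoc : ∀ a b d → a * b * d ≡ b * (a * d)
      reassoc = solve-∀

    ‖‖²-columns : ‖ M ‖² ≡ sumFin n (λ j → ⟨ column M j , column M j ⟩)
    ‖‖²-columns = sumFin-comm m n _

    bilinear-secondMoment :
      ∑[ A ← cube m ] ∑[ B ← cube n ] (bilinear A B M * bilinear A B M) ≡ + (2 ℕ.^ m) * + (2 ℕ.^ n) * ‖ M ‖²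
    bilinear-secondMoment = begin
      ∑[ A ← cube m ] ∑[ B ← cube n ] (bilinear A B M * bilinear A B M)
        ≡⟨ ∑-cong (cube m) (λ A → ∑-cong (cube n) (λ B → cong (λ t → t * t) (bilinear-signed A B))) ⟩
      ∑[ A ← cube m ] ∑[ B ← cube n ] (⟨ signs B , c A ⟩ * ⟨ signs B , c A ⟩)
        ≡⟨ ∑-cong (cube m) (λ A → signed-secondMoment n (c A) (c A)) ⟩
      ∑[ A ← cube m ] (Pₙ * ⟨ c A , c A ⟩)
        ≡⟨ sym (*-distribˡ-∑ (cube m) Pₙ _) ⟩
      Pₙ * ∑[ A ← cube m ] ⟨ c A , c A ⟩
        ≡⟨ cong (Pₙ *_) (∑-sumFin-comm (cube m) n _) ⟩
      Pₙ * sumFin n (λ j → ∑[ A ← cube m ] (c A j * c A j))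
        ≡⟨ cong (Pₙ *_) (sumFin-cong n (λ j → signed-secondMoment m (column M j) (column M j))) ⟩
      Pₙ * sumFin n (λ j → Pₘ * ⟨ column M j , column M j ⟩)
        ≡⟨ cong (Pₙ *_) (sym (*-distribˡ-sumFin n Pₘ _)) ⟩
      Pₙ * (Pₘ * sumFin n (λ j → ⟨ column M j , column M j ⟩))
        ≡⟨ cong (λ h → Pₙ * (Pₘ * h)) (sym ‖‖²-columns) ⟩
      Pₙ * (Pₘ * ‖ M ‖²)
        ≡⟨ swap Pₙ Pₘ ‖ M ‖² ⟩
      Pₘ * Pₙ * ‖ M ‖² ∎
      where
      open ≡.≡-Reasoning
      c = combineRows
      Pₘ = + (2 ℕ.^ m)
      Pₙ = + (2 ℕ.^ n)
      swap : ∀ p q h → p * (q * h) ≡ q * p * h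
      swap = solve-∀

    combineRows-fourthMoment-≤ :
      ∑[ A ← cube m ] (⟨ combineRows A , combineRows A ⟩ * ⟨ combineRows A , combineRows A ⟩)
        ≤ + 3 * + (2 ℕ.^ m) * (‖ M ‖² * ‖ M ‖²)
    combineRows-fourthMoment-≤ = begin
      ∑[ A ← cube m ] (⟨ c A , c A ⟩ * ⟨ c A , c A ⟩)
        ≡⟨ ∑-cong (cube m) (λ A → sumFin-*-sumFin n n _ _) ⟩
      ∑[ A ← cube m ] sumFin n (λ j → sumFin n (λ l → c A j * c A j * (c A l * c A l)))
        ≡⟨ ∑-sumFin-comm (cube m) n _ ⟩
      sumFin n (λ j → ∑[ A ← cube m ] sumFin n (λ l → c A j * c A j * (c A l * c A l)))
        ≡⟨ sumFin-cong n (λ j → ∑-sumFin-comm (cube m) n _) ⟩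
      sumFin n (λ j → sumFin n (λ l → ∑[ A ← cube m ] (c A j * c A j * (c A l * c A l))))
        ≤⟨ sumFin-mono-≤ n (λ j → sumFin-mono-≤ n (λ l → signed-fourthMoment-≤ m (column M j) (column M l))) ⟩
      sumFin n (λ j → sumFin n (λ l → + 3 * Pₘ * (‖col‖² j * ‖col‖² l)))
        ≡⟨ sumFin-cong n (λ j → sym (*-distribˡ-sumFin n (+ 3 * Pₘ) _)) ⟩
      sumFin n (λ j → + 3 * Pₘ * sumFin n (λ l → ‖col‖² j * ‖col‖² l))
        ≡⟨ sym (*-distribˡ-sumFin n (+ 3 * Pₘ) _) ⟩
      + 3 * Pₘ * sumFin n (λ j → sumFin n (λ l → ‖col‖² j * ‖col‖² l))
        ≡⟨ cong (+ 3 * Pₘ *_) (sym (sumFin-*-sumFin n n ‖col‖² ‖col‖²)) ⟩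
      + 3 * Pₘ * (sumFin n ‖col‖² * sumFin n ‖col‖²)
        ≡⟨ cong (λ h → + 3 * Pₘ * (h * h)) (sym ‖‖²-columns) ⟩
      + 3 * Pₘ * (‖ M ‖² * ‖ M ‖²) ∎
      where
      open ℤ.≤-Reasoning
      c = combineRows
      Pₘ = + (2 ℕ.^ m)
      ‖col‖² : Fin n → ℤ
      ‖col‖² j = ⟨ column M j , column M j ⟩

    bilinear-fourthMoment-≤ :
      ∑[ A ← cube m ] ∑[ B ← cube n ] (bilinear A B M * bilinear A B M * (bilinear A B M * bilinear A B M))
        ≤ + 9 * (+ (2 ℕ.^ m) * + (2 ℕ.^ n)) * (‖ M ‖² * ‖ M ‖²)
    bilinear-fourthMoment-≤ = begin
      ∑[ A ← cube m ] ∑[ B ← cube n ] (bilinear A B M * bilinear A B M * (bilinear A B M * bilinear A B M))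
        ≡⟨ ∑-cong (cube m) (λ A → ∑-cong (cube n) (λ B → cong (λ t → t * t * (t * t)) (bilinear-signed A B))) ⟩
      ∑[ A ← cube m ] ∑[ B ← cube n ]
        (⟨ signs B , c A ⟩ * ⟨ signs B , c A ⟩ * (⟨ signs B , c A ⟩ * ⟨ signs B , c A ⟩))
        ≤⟨ ∑-mono-≤ (cube m) (λ A → signed-fourthMoment-≤ n (c A) (c A)) ⟩
      ∑[ A ← cube m ] (+ 3 * Pₙ * (⟨ c A , c A ⟩ * ⟨ c A , c A ⟩))
        ≡⟨ sym (*-distribˡ-∑ (cube m) (+ 3 * Pₙ) _) ⟩
      + 3 * Pₙ * ∑[ A ← cube m ] (⟨ c A , c A ⟩ * ⟨ c A , c A ⟩)
        ≤⟨ ℤ.*-monoˡ-≤-nonNeg (+ 3 * Pₙ) {{ℤ.nonNegative (0≤i*j {+ 3} {Pₙ} (+≤+ ℕ.z≤n) (+≤+ ℕ.z≤n))}}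
             combineRows-fourthMoment-≤ ⟩
      + 3 * Pₙ * (+ 3 * Pₘ * (‖ M ‖² * ‖ M ‖²))
        ≡⟨ regroup Pₘ Pₙ _ ⟩
      + 9 * (Pₘ * Pₙ) * (‖ M ‖² * ‖ M ‖²) ∎
      where
      open ℤ.≤-Reasoning
      c = combineRows
      Pₘ = + (2 ℕ.^ m)
      Pₙ = + (2 ℕ.^ n)
      regroup : ∀ p q h → + 3 * q * (+ 3 * p * h) ≡ + 9 * (p * q) * h
      regroup = solve-∀

module PaleyZygmund where
  open import Data.Integer using (+_; -_; 0ℤ; _+_; _-_; _*_; _≤_; _<_; +≤+)
  open import Data.Integer.Tactic.RingSolver using (solve-∀)
  open ≡ using (sym; trans; cong; subst; subst₂)
  open ℤ∑
  open IntegerSums using (0≤i*i; 0≤i*j; i+k≡j⇒i≤j; ∑-nonNeg)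

  module _ {A : Set} where

    ∑-sq-sub : ∀ (xs : List A) f a →
      ∑[ x ← xs ] ((f x - a) * (f x - a)) ≡ ∑[ x ← xs ] (f x * f x) - + 2 * a * ∑ xs f + + length xs * (a * a)
    ∑-sq-sub []       f a = empty a
      where
      empty : ∀ a → 0ℤ ≡ 0ℤ - + 2 * a * 0ℤ + 0ℤ * (a * a)
      empty = solve-∀
    ∑-sq-sub (x ∷ xs) f a = trans (cong (_+_ ((f x - a) * (f x - a))) (∑-sq-sub xs f a))
      (step (f x) a (∑[ y ← xs ] (f y * f y)) (∑ xs f) (+ length xs))
      where
      step : ∀ b a Q S L → (b - a) * (b - a) + (Q - + 2 * a * S + L * (a * a))
        ≡ b * b + Q - + 2 * a * (b + S) + (+ 1 + L) * (a * a)
      step = solve-∀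

    cauchy-schwarz : ∀ (xs : List A) f → ∑ xs f * ∑ xs f ≤ + length xs * ∑[ x ← xs ] (f x * f x)
    cauchy-schwarz []       f = ℤ.≤-refl
    cauchy-schwarz (x ∷ xs) f = i+k≡j⇒i≤j
      (ℤ.+-mono-≤ (ℤ.i≤j⇒0≤j-i (cauchy-schwarz xs f))
                  (subst (0ℤ ≤_) (∑-sq-sub xs f (f x)) (∑-nonNeg xs (λ y → 0≤i*i (f y - f x)))))
      (step (f x) (∑ xs f) (∑[ y ← xs ] (f y * f y)) (+ length xs))
      where
      step : ∀ a S Q L →
        (a + S) * (a + S) + ((L * Q - S * S) + (Q - + 2 * a * S + L * (a * a))) ≡ (+ 1 + L) * (a * a + Q)
      step = solve-∀

    ∑-filter-≤ : ∀ {P : A → Set} (P? : Decidable P) xs {f} → (∀ x → 0ℤ ≤ f x) → ∑ (filter P? xs) f ≤ ∑ xs f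
    ∑-filter-≤ P? []       0≤f = ℤ.≤-refl
    ∑-filter-≤ P? (x ∷ xs) {f} 0≤f with does (P? x)
    ... | true  = ℤ.+-monoʳ-≤ (f x) (∑-filter-≤ P? xs 0≤f)
    ... | false = ℤ.≤-trans (∑-filter-≤ P? xs 0≤f) (ℤ.i≤j+i (∑ xs f) (f x) {{ℤ.nonNegative (0≤f x)}})

  square-mono-≤ : ∀ {i j} → 0ℤ ≤ i → i ≤ j → i * i ≤ j * j
  square-mono-≤ {i} {j} 0≤i i≤j = ℤ.≤-trans (ℤ.*-monoˡ-≤-nonNeg i {{ℤ.nonNegative 0≤i}} i≤j)
    (ℤ.*-monoʳ-≤-nonNeg j {{ℤ.nonNegative (ℤ.≤-trans 0≤i i≤j)}} i≤j)

  *-cancelʳ-≤-square : ∀ {a b L h} → 0ℤ < h →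
    + a * (+ ℕ.suc L * (h * h)) ≤ + b * (+ ℕ.suc L * (h * h)) → a ℕ.≤ b
  *-cancelʳ-≤-square {a} {b} {h = ℤ.+[1+ _ ]} _         p = ℤ.drop‿+≤+ (ℤ.*-cancelʳ-≤-pos (+ a) (+ b) _ p)
  *-cancelʳ-≤-square         {h = + ℕ.zero}   (ℤ.+<+ ()) _

  module _ {A : Set} (w : A → ℤ) (h : ℤ) where

    Heavy : A → Set
    Heavy x = h ≤ + 4 * w x

    heavy? : Decidable Heavy
    heavy? x = h ℤ.≤? + 4 * w x

    ∑-≤-∑-heavy : 0ℤ ≤ h → ∀ xs → + 4 * ∑ xs w ≤ + 4 * ∑ (filter heavy? xs) w + + length xs * h
    ∑-≤-∑-heavy 0≤h []       = ℤ.≤-refl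
    ∑-≤-∑-heavy 0≤h (x ∷ xs) with heavy? x
    ... | yes _ = begin
      + 4 * (w x + ∑ xs w)                      ≡⟨ ℤ.*-distribˡ-+ (+ 4) (w x) _ ⟩
      + 4 * w x + + 4 * ∑ xs w                  ≤⟨ ℤ.+-monoʳ-≤ (+ 4 * w x) (∑-≤-∑-heavy 0≤h xs) ⟩
      + 4 * w x + (+ 4 * ∑ heavies w + L * h)   ≤⟨ i+k≡j⇒i≤j 0≤h (step (w x) (∑ heavies w) L h) ⟩
      + 4 * (w x + ∑ heavies w) + (+ 1 + L) * h ∎
      where
      open ℤ.≤-Reasoning
      heavies = filter heavy? xs
      L = + length xs
      step : ∀ a S L h → + 4 * a + (+ 4 * S + L * h) + h ≡ + 4 * (a + S) + (+ 1 + L) * h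
      step = solve-∀
    ... | no light = begin
      + 4 * (w x + ∑ xs w)                      ≡⟨ ℤ.*-distribˡ-+ (+ 4) (w x) _ ⟩
      + 4 * w x + + 4 * ∑ xs w                  ≤⟨ ℤ.+-mono-≤ (ℤ.<⇒≤ (ℤ.≰⇒> light)) (∑-≤-∑-heavy 0≤h xs) ⟩
      h + (+ 4 * ∑ heavies w + L * h)           ≡⟨ step (∑ heavies w) L h ⟩
      + 4 * ∑ heavies w + (+ 1 + L) * h ∎
      where
      open ℤ.≤-Reasoning
      heavies = filter heavy? xs
      L = + length xs
      step : ∀ S L h → h + (+ 4 * S + L * h) ≡ + 4 * S + (+ 1 + L) * h
      step = solve-∀

    heavy-mass : 0ℤ ≤ h → ∀ xs → + length xs * h ≤ ∑ xs w → + 3 * (+ length xs * h) ≤ + 4 * ∑ (filter heavy? xs) w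
    heavy-mass 0≤h xs mean≥ = subst₂ _≤_ (four-minus-one (N * h)) (cancel (+ 4 * ∑ (filter heavy? xs) w) (N * h))
      (ℤ.+-monoˡ-≤ (- (N * h)) (ℤ.≤-trans (ℤ.*-monoˡ-≤-nonNeg (+ 4) mean≥) (∑-≤-∑-heavy 0≤h xs)))
      where
      N = + length xs
      four-minus-one : ∀ t → + 4 * t + - t ≡ + 3 * t
      four-minus-one = solve-∀
      cancel : ∀ s t → s + t + - t ≡ s
      cancel = solve-∀

    paley-zygmund : ∀ xs c → 0ℤ < h →
      + length xs * h ≤ ∑ xs w →
      ∑[ x ← xs ] (w x * w x) ≤ + c * (+ length xs * (h * h)) →
      9 ℕ.* length xs ℕ.≤ 16 ℕ.* c ℕ.* length (filter heavy? xs)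
    paley-zygmund []           c 0<h mean≥ secondMoment≤ = ℕ.z≤n
    paley-zygmund xs@(_ ∷ ys) c 0<h mean≥ secondMoment≤ = *-cancelʳ-≤-square {L = length ys} 0<h (begin
      + (9 ℕ.* length xs) * (N * (h * h))       ≡⟨ cong (_* (N * (h * h))) (ℤ.pos-* 9 (length xs)) ⟩
      + 9 * N * (N * (h * h))                   ≡⟨ square-3Nh N h ⟩
      + 3 * (N * h) * (+ 3 * (N * h))           ≤⟨ square-mono-≤ 0≤3Nh (heavy-mass (ℤ.<⇒≤ 0<h) xs mean≥) ⟩
      + 4 * S * (+ 4 * S)                       ≡⟨ square-4S S ⟩
      + 16 * (S * S)                            ≤⟨ ℤ.*-monoˡ-≤-nonNeg (+ 16) (cauchy-schwarz heavies w) ⟩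
      + 16 * (e * ∑[ x ← heavies ] (w x * w x)) ≤⟨ ℤ.*-monoˡ-≤-nonNeg (+ 16) (ℤ.*-monoˡ-≤-nonNeg e
                                                     (ℤ.≤-trans (∑-filter-≤ heavy? xs (λ x → 0≤i*i (w x))) secondMoment≤)) ⟩
      + 16 * (e * (+ c * (N * (h * h))))        ≡⟨ regroup e (+ c) (N * (h * h)) ⟩
      + 16 * + c * e * (N * (h * h))            ≡⟨ cong (λ t → t * e * (N * (h * h))) (sym (ℤ.pos-* 16 c)) ⟩
      + (16 ℕ.* c) * e * (N * (h * h))          ≡⟨ cong (_* (N * (h * h))) (sym (ℤ.pos-* (16 ℕ.* c) (length heavies))) ⟩
      + (16 ℕ.* c ℕ.* length heavies) * (N * (h * h)) ∎)
      where
      open ℤ.≤-Reasoning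
      N = + length xs
      heavies = filter heavy? xs
      S = ∑ heavies w
      e = + length heavies
      0≤3Nh : 0ℤ ≤ + 3 * (N * h)
      0≤3Nh = 0≤i*j {+ 3} (+≤+ ℕ.z≤n) (0≤i*j {N} (+≤+ ℕ.z≤n) (ℤ.<⇒≤ 0<h))
      square-3Nh : ∀ N h → + 9 * N * (N * (h * h)) ≡ + 3 * (N * h) * (+ 3 * (N * h))
      square-3Nh = solve-∀
      square-4S : ∀ S → + 4 * S * (+ 4 * S) ≡ + 16 * (S * S)
      square-4S = solve-∀
      regroup : ∀ e c k → + 16 * (e * (c * k)) ≡ + 16 * c * e * k
      regroup = solve-∀

module FewGoodTuples where
  open import Data.Nat using (ℕ; zero; suc; _+_; _*_; _^_; _≤_; _≤?_)
  open import Data.Nat.Tactic.RingSolver using (solve-∀)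
  open import Data.Bool using (if_then_else_)
  open import Data.Fin.Subset using (Subset; _∈_; ∣_∣)
  open import Data.Vec.Base using (here; there)
  open ≡ using (refl; sym; trans; cong)
  open ℕ∑

  markov : ∀ {A : Set} {P : A → Set} (P? : Decidable P) c f xs →
    (∀ x → P x → c ≤ f x) → c * length (filter P? xs) ≤ ∑ xs f
  markov P? c f []       c≤f = ℕ.≤-reflexive (ℕ.*-zeroʳ c)
  markov P? c f (x ∷ xs) c≤f with P? x
  ... | yes px = ℕ.≤-trans (ℕ.≤-reflexive (ℕ.*-suc c _)) (ℕ.+-mono-≤ (c≤f x px) (markov P? c f xs c≤f))
  ... | no _   = ℕ.≤-trans (markov P? c f xs c≤f) (ℕ.m≤n+m _ (f x))

  module _ {Q : Set} {G : Q → Set} (G? : Decidable G) where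

    goodPositions : ∀ {k} → Vec Q k → Subset k
    goodPositions []       = []
    goodPositions (q ∷ qs) = does (G? q) ∷ goodPositions qs

    goodCount : ∀ {k} → Vec Q k → ℕ
    goodCount qs = ∣ goodPositions qs ∣

    ∈-goodPositions : ∀ {k} (qs : Vec Q k) {t} → t ∈ goodPositions qs → G (lookup qs t)
    ∈-goodPositions (q ∷ qs) {zero}  q∈ with G? q
    ∈-goodPositions (q ∷ qs) {zero}  here | yes g = g
    ∈-goodPositions (q ∷ qs) {zero}  ()   | no _
    ∈-goodPositions (q ∷ qs) {suc t} (there t∈) = ∈-goodPositions qs t∈

    goodCount-all : (∀ q → G q) → ∀ {k} (qs : Vec Q k) → goodCount qs ≡ k
    goodCount-all all []       = refl
    goodCount-all all (q ∷ qs) with G? q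
    ... | yes _ = cong suc (goodCount-all all qs)
    ... | no ¬g = contradiction (all q) ¬g

    -- A tuple weighs 2^(number of non-good entries).  The total weight factorises as (∑ weight)^k,
    -- while a tuple with at most m good entries weighs at least 2^(k − m).
    weight : Q → ℕ
    weight q = if does (G? q) then 1 else 2

    tupleWeight : ∀ {k} → Vec Q k → ℕ
    tupleWeight []       = 1
    tupleWeight (q ∷ qs) = weight q * tupleWeight qs

    2^k≡2^goodCount*tupleWeight : ∀ {k} (qs : Vec Q k) → 2 ^ k ≡ 2 ^ goodCount qs * tupleWeight qs
    2^k≡2^goodCount*tupleWeight []       = refl
    2^k≡2^goodCount*tupleWeight (q ∷ qs) with G? q
    ... | yes _ = trans (cong (2 *_) (2^k≡2^goodCount*tupleWeight qs)) (good (2 ^ goodCount qs) (tupleWeight qs))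
      where
      good : ∀ p t → 2 * (p * t) ≡ 2 * p * (1 * t)
      good = solve-∀
    ... | no _  = trans (cong (2 *_) (2^k≡2^goodCount*tupleWeight qs)) (bad (2 ^ goodCount qs) (tupleWeight qs))
      where
      bad : ∀ p t → 2 * (p * t) ≡ p * (2 * t)
      bad = solve-∀

    ∑-tupleWeight : ∀ Ω k → ∑ (vecsOver Ω k) tupleWeight ≡ ∑ Ω weight ^ k
    ∑-tupleWeight Ω zero    = refl
    ∑-tupleWeight Ω (suc k) = begin
      ∑ (vecsOver Ω (suc k)) tupleWeight                    ≡⟨ ∑-cartesianProductWith _∷_ Ω (vecsOver Ω k) tupleWeight ⟩
      ∑[ q ← Ω ] ∑[ qs ← vecsOver Ω k ] (weight q * tupleWeight qs)
        ≡⟨ ∑-cong Ω (λ q → sym (*-distribˡ-∑ (vecsOver Ω k) (weight q) tupleWeight)) ⟩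
      ∑[ q ← Ω ] (weight q * ∑ (vecsOver Ω k) tupleWeight)
        ≡⟨ ∑-cong Ω (λ q → cong (weight q *_) (∑-tupleWeight Ω k)) ⟩
      ∑[ q ← Ω ] (weight q * ∑ Ω weight ^ k)               ≡⟨ sym (*-distribʳ-∑ Ω (∑ Ω weight ^ k) weight) ⟩
      ∑ Ω weight * ∑ Ω weight ^ k                          ∎
      where open ≡.≡-Reasoning

    ∑-weight : ∀ Ω → ∑ Ω weight + length (filter G? Ω) ≡ 2 * length Ω
    ∑-weight []      = refl
    ∑-weight (q ∷ Ω) with G? q
    ... | yes _ = trans (regroup (∑ Ω weight) (length (filter G? Ω))) (trans (cong (2 +_) (∑-weight Ω)) (sym (ℕ.*-suc 2 _)))
      where
      regroup : ∀ W e → 1 + W + (1 + e) ≡ 2 + (W + e)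
      regroup = solve-∀
    ... | no _  = trans (cong (2 +_) (∑-weight Ω)) (sym (ℕ.*-suc 2 _))

    fewGood : List Q → ∀ k m → List (Vec Q k)
    fewGood Ω k m = filter (λ qs → goodCount qs ≤? m) (vecsOver Ω k)

    length-fewGood : ∀ Ω k m → 2 ^ k * length (fewGood Ω k m) ≤ 2 ^ m * ∑ Ω weight ^ k
    length-fewGood Ω k m = begin
      2 ^ k * length (fewGood Ω k m)
        ≤⟨ markov (λ qs → goodCount qs ≤? m) (2 ^ k) (λ qs → 2 ^ m * tupleWeight qs) (vecsOver Ω k) few⇒bound ⟩
      ∑[ qs ← vecsOver Ω k ] (2 ^ m * tupleWeight qs) ≡⟨ sym (*-distribˡ-∑ (vecsOver Ω k) (2 ^ m) tupleWeight) ⟩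
      2 ^ m * ∑ (vecsOver Ω k) tupleWeight          ≡⟨ cong (2 ^ m *_) (∑-tupleWeight Ω k) ⟩
      2 ^ m * ∑ Ω weight ^ k                        ∎
      where
      open ℕ.≤-Reasoning
      few⇒bound : ∀ qs → goodCount qs ≤ m → 2 ^ k ≤ 2 ^ m * tupleWeight qs
      few⇒bound qs few = ℕ.≤-trans (ℕ.≤-reflexive (2^k≡2^goodCount*tupleWeight qs))
                                   (ℕ.*-monoˡ-≤ (tupleWeight qs) (ℕ.^-monoʳ-≤ 2 few))

module Numerics where
  open import Data.Nat using (zero; suc; _+_; _*_; _^_; _≤_; _∸_)
  open import Data.Nat.Tactic.RingSolver using (solve-∀)
  open ≡ using (refl; sym; trans; cong; subst)

  ^-distrib-* : ∀ a b k → (a * b) ^ k ≡ a ^ k * b ^ k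
  ^-distrib-* a b zero    = refl
  ^-distrib-* a b (suc k) = trans (cong (a * b *_) (^-distrib-* a b k)) (interchange a b (a ^ k) (b ^ k))
    where
    interchange : ∀ a b c d → a * b * (c * d) ≡ a * c * (b * d)
    interchange = solve-∀

  -- (32/31)^128 ≈ 58 > 32, so (32/31)^(128x) beats 32^x, with room for the factor 6 once x ≥ 4.
  6*32^x*31^k≤32^k : ∀ x k → 4 ≤ x → 128 * x ≤ k → 6 * 32 ^ x * 31 ^ k ≤ 32 ^ k
  6*32^x*31^k≤32^k x k 4≤x 128x≤k = begin
    6 * 32 ^ x * 31 ^ k                              ≡⟨ cong (λ t → 6 * 32 ^ x * 31 ^ t) (sym k≡) ⟩
    6 * 32 ^ x * 31 ^ (128 * x + r)                  ≡⟨ cong (6 * 32 ^ x *_) (split 31) ⟩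
    6 * 32 ^ x * ((31 ^ 128) ^ x * 31 ^ r)           ≡⟨ ℕ.*-assoc (6 * 32 ^ x) _ _ ⟨
    6 * 32 ^ x * (31 ^ 128) ^ x * 31 ^ r             ≤⟨ ℕ.*-mono-≤ (base x 4≤x) (ℕ.^-monoˡ-≤ r (ℕ.n≤1+n 31)) ⟩
    (32 ^ 128) ^ x * 32 ^ r                          ≡⟨ split 32 ⟨
    32 ^ (128 * x + r)                               ≡⟨ cong (32 ^_) k≡ ⟩
    32 ^ k                                           ∎
    where
    open ℕ.≤-Reasoning
    r = k ∸ 128 * x
    k≡ : 128 * x + r ≡ k
    k≡ = ℕ.m+[n∸m]≡n 128x≤k
    split : ∀ a → a ^ (128 * x + r) ≡ (a ^ 128) ^ x * a ^ r
    split a = trans (ℕ.^-distribˡ-+-* a (128 * x) r) (cong (_* a ^ r) (sym (ℕ.^-*-assoc a 128 x)))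
    base : ∀ x → 4 ≤ x → 6 * 32 ^ x * (31 ^ 128) ^ x ≤ (32 ^ 128) ^ x
    base x 4≤x = subst (λ x → 6 * 32 ^ x * (31 ^ 128) ^ x ≤ (32 ^ 128) ^ x) (ℕ.m+[n∸m]≡n 4≤x) (from4 (x ∸ 4))
      where
      from4 : ∀ y → 6 * 32 ^ (4 + y) * (31 ^ 128) ^ (4 + y) ≤ (32 ^ 128) ^ (4 + y)
      from4 zero    = ℕ.≤ᵇ⇒≤ (6 * 32 ^ 4 * (31 ^ 128) ^ 4) ((32 ^ 128) ^ 4) _
      from4 (suc y) = begin
        6 * (32 * 32 ^ (4 + y)) * (31 ^ 128 * (31 ^ 128) ^ (4 + y))
          ≡⟨ regroup 32 (31 ^ 128) (32 ^ (4 + y)) ((31 ^ 128) ^ (4 + y)) ⟩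
        32 * 31 ^ 128 * (6 * 32 ^ (4 + y) * (31 ^ 128) ^ (4 + y))
          ≤⟨ ℕ.*-mono-≤ (ℕ.≤ᵇ⇒≤ (32 * 31 ^ 128) (32 ^ 128) _) (from4 y) ⟩
        32 ^ 128 * (32 ^ 128) ^ (4 + y) ∎
        where
        regroup : ∀ a c p q → 6 * (a * p) * (c * q) ≡ a * c * (6 * p * q)
        regroup = solve-∀

queries : ∀ n → List (OPQuery n)
queries n = cartesianProduct (cube n) (cube n)

length-queries : ∀ n → length (queries n) ≡ 2 ℕ.^ n ℕ.* 2 ℕ.^ n
length-queries n = ≡.trans (length-cartesianProductWith _,_ (cube n) (cube n))
  (≡.cong₂ ℕ._*_ (length-cube n) (length-cube n))

∈-queries : ∀ {n} (q : OPQuery n) → q ∈ₗ queries n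
∈-queries (A , B) = ∈-cartesianProduct⁺ (∈-cube A) (∈-cube B)

module OneDataset {n : ℕ} (k : ℕ) (X Y : Dataset n) where
  open import Data.Integer using (+_; 0ℤ; _-_; _*_; _^_; _≤_; _<_; +<+)
  open import Data.Integer.Tactic.RingSolver using (solve-∀)
  open ≡ using (refl; sym; trans; cong; cong₂; subst; subst₂)
  open ℤ∑
  open IntegerSums using (0≤i*i; sumFin-cong; sumFin-nonNeg)
  open BilinearForms
  open PaleyZygmund using (Heavy; heavy?; paley-zygmund; square-mono-≤)
  open FewGoodTuples

  difference : Fin n → Fin n → ℤ
  difference i j = bit (X i j) - bit (Y i j)

  H : ℤ
  H = hamming X Y

  N : ℕ
  N = length (queries n)

  w : OPQuery n → ℤ
  w q = dotDiff q X Y * dotDiff q X Y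

  m : ℕ
  m = 4 ℕ.* n ℕ.^ 2

  hamming≡‖difference‖² : H ≡ ‖ difference ‖²
  hamming≡‖difference‖² = sumFin-cong n λ i → sumFin-cong n λ j → ∣bit-bit∣≡square (X i j) (Y i j)
    where
    ∣bit-bit∣≡square : ∀ x y → + ℤ.∣ bit x - bit y ∣ ≡ (bit x - bit y) * (bit x - bit y)
    ∣bit-bit∣≡square true  true  = refl
    ∣bit-bit∣≡square true  false = refl
    ∣bit-bit∣≡square false true  = refl
    ∣bit-bit∣≡square false false = refl

  2ⁿ*2ⁿ≡N : + (2 ℕ.^ n) * + (2 ℕ.^ n) ≡ + N
  2ⁿ*2ⁿ≡N = trans (sym (ℤ.pos-* (2 ℕ.^ n) (2 ℕ.^ n))) (cong +_ (sym (length-queries n)))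

  ∑-w≡N*H : ∑ (queries n) w ≡ + N * H
  ∑-w≡N*H = begin
    ∑ (queries n) w                                        ≡⟨ ∑-cartesianProductWith _,_ (cube n) (cube n) w ⟩
    ∑[ A ← cube n ] ∑[ B ← cube n ] w (A , B)              ≡⟨ bilinear-secondMoment difference ⟩
    + (2 ℕ.^ n) * + (2 ℕ.^ n) * ‖ difference ‖²           ≡⟨ cong₂ _*_ 2ⁿ*2ⁿ≡N (sym hamming≡‖difference‖²) ⟩
    + N * H                                                ∎
    where open ≡.≡-Reasoning

  ∑-w²≤9*N*H² : ∑[ q ← queries n ] (w q * w q) ≤ + 9 * (+ N * (H * H))
  ∑-w²≤9*N*H² = begin
    ∑[ q ← queries n ] (w q * w q)                          ≡⟨ ∑-cartesianProductWith _,_ (cube n) (cube n) _ ⟩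
    ∑[ A ← cube n ] ∑[ B ← cube n ] (w (A , B) * w (A , B)) ≤⟨ bilinear-fourthMoment-≤ difference ⟩
    + 9 * (+ (2 ℕ.^ n) * + (2 ℕ.^ n)) * (‖ difference ‖² * ‖ difference ‖²)
      ≡⟨ cong₂ (λ p h → + 9 * p * (h * h)) 2ⁿ*2ⁿ≡N (sym hamming≡‖difference‖²) ⟩
    + 9 * + N * (H * H)                                     ≡⟨ ℤ.*-assoc (+ 9) (+ N) (H * H) ⟩
    + 9 * (+ N * (H * H))                                   ∎
    where open ℤ.≤-Reasoning

  Good : OPQuery n → Set
  Good = Heavy w H

  good? : Decidable Good
  good? = heavy? w H

  0≤H : 0ℤ ≤ H
  0≤H = subst (0ℤ ≤_) (sym hamming≡‖difference‖²)
    (sumFin-nonNeg n λ i → sumFin-nonNeg n λ j → 0≤i*i (difference i j))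

  module _ (bad : Bad n k X Y) where

    0<H : 0ℤ < H
    0<H = positive H 0≤H bad
      where
      positive : ∀ h → 0ℤ ≤ h → + (128 ℕ.* n ℕ.^ 6) < + k * h ^ 2 → 0ℤ < h
      positive ℤ.+[1+ _ ] _ _ = +<+ (ℕ.s≤s ℕ.z≤n)
      positive (+ 0)      _ p with +<+ () ← subst (+ (128 ℕ.* n ℕ.^ 6) <_) (ℤ.*-zeroʳ (+ k)) p

    N≤16*good : N ℕ.≤ 16 ℕ.* length (filter good? (queries n))
    N≤16*good = ℕ.*-cancelˡ-≤ 9 (ℕ.≤-trans
      (paley-zygmund w H (queries n) 9 0<H (ℤ.≤-reflexive (sym ∑-w≡N*H)) ∑-w²≤9*N*H²)
      (ℕ.≤-reflexive (ℕ.*-assoc 9 16 (length (filter good? (queries n))))))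

    good⇒exceeds : ∀ q → Good q → Exceeds n k X Y q
    good⇒exceeds q good = ℤ.*-cancelˡ-<-nonNeg (+ 16) (begin-strict
      + 16 * + (8 ℕ.* n ℕ.^ 6)   ≡⟨ sym (ℤ.pos-* 16 (8 ℕ.* n ℕ.^ 6)) ⟩
      + (16 ℕ.* (8 ℕ.* n ℕ.^ 6)) ≡⟨ cong +_ (sym (ℕ.*-assoc 16 8 (n ℕ.^ 6))) ⟩
      + (128 ℕ.* n ℕ.^ 6)        <⟨ bad ⟩
      + k * H ^ 2                ≤⟨ ℤ.*-monoˡ-≤-nonNeg (+ k) H²≤16d⁴ ⟩
      + k * (+ 16 * d ^ 4)       ≡⟨ swap (+ k) (d ^ 4) ⟩
      + 16 * (+ k * d ^ 4)       ∎)
      where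
      open ℤ.≤-Reasoning
      d = dotDiff q X Y
      H²≤16d⁴ : H ^ 2 ≤ + 16 * d ^ 4
      H²≤16d⁴ = subst₂ _≤_ (square H) (fourth d) (square-mono-≤ 0≤H good)
        where
        square : ∀ h → h * h ≡ h ^ 2
        square h = cong (h *_) (sym (ℤ.*-identityʳ h))
        fourth : ∀ d → + 4 * (d * d) * (+ 4 * (d * d)) ≡ + 16 * (d * (d * (d * (d * + 1))))
        fourth = solve-∀
      swap : ∀ a b → a * (+ 16 * b) ≡ + 16 * (a * b)
      swap = solve-∀

    uncaught⇒fewGood : ∀ qs → ¬ Catches n k X qs Y → goodCount good? qs ℕ.≤ m
    uncaught⇒fewGood qs uncaught = ℕ.≮⇒≥ λ m<goodCount →
      uncaught (goodPositions good? qs , m<goodCount , λ t t∈ → good⇒exceeds (lookup qs t) (∈-goodPositions good? qs t∈))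


-- The numerical bound needs n² ≥ 4; for n = 1 instead every query is good, so no bad dataset escapes.
module OneByOne (k : ℕ) (X Y : Dataset 1) where
  open import Data.Integer using (+_; 0ℤ; _+_; _*_; _≤_; +≤+)
  open import Data.Integer.Tactic.RingSolver using (solve-∀)
  open ≡ using (sym; cong₂; subst)
  open IntegerSums using (0≤i*j; i+k≡j⇒i≤j)
  open OneDataset k X Y

  all-good : ∀ q → Good q
  all-good q@(a ∷ [] , b ∷ []) = subst (λ t → H ≤ + 4 * t) (sym w≡H) H≤4H
    where
    d = difference zero zero
    sgn² : ∀ x → sgn x * sgn x ≡ + 1
    sgn² true  = ≡.refl
    sgn² false = ≡.refl
    w≡H : w q ≡ H
    w≡H = begin
      w q                                                     ≡⟨ expand (sgn a) (sgn b) d ⟩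
      sgn a * sgn a * (sgn b * sgn b) * (d * d + 0ℤ + 0ℤ)
        ≡⟨ cong₂ (λ s t → s * t * (d * d + 0ℤ + 0ℤ)) (sgn² a) (sgn² b) ⟩
      + 1 * + 1 * (d * d + 0ℤ + 0ℤ)                           ≡⟨ ℤ.*-identityˡ _ ⟩
      d * d + 0ℤ + 0ℤ                                         ≡⟨ sym hamming≡‖difference‖² ⟩
      H                                                       ∎
      where
      open ≡.≡-Reasoning
      expand : ∀ s t d → (s * t * d + 0ℤ + 0ℤ) * (s * t * d + 0ℤ + 0ℤ) ≡ s * s * (t * t) * (d * d + 0ℤ + 0ℤ)
      expand = solve-∀
    H≤4H : H ≤ + 4 * H
    H≤4H = i+k≡j⇒i≤j (0≤i*j {+ 3} (+≤+ ℕ.z≤n) 0≤H) (four H)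
      where
      four : ∀ h → h + + 3 * h ≡ + 4 * h
      four = solve-∀

open import Data.Nat using (_+_; _*_; _^_; _≤_; _<_; z≤n; s≤s)
open ℕ∑
open FewGoodTuples
open Numerics

module _ {n : ℕ} (k : ℕ) (X Y : Dataset n) (bad : Bad n k X Y) where
  open OneDataset k X Y

  16*∑weight≤31*N : 16 * ∑ (queries n) (weight good?) ≤ 31 * N
  16*∑weight≤31*N = ℕ.+-cancelʳ-≤ N (16 * W) (31 * N) (begin
    16 * W + N        ≤⟨ ℕ.+-monoʳ-≤ (16 * W) (N≤16*good bad) ⟩
    16 * W + 16 * e   ≡⟨ ℕ.*-distribˡ-+ 16 W e ⟨
    16 * (W + e)      ≡⟨ ≡.cong (16 *_) (∑-weight good? (queries n)) ⟩
    16 * (2 * N)      ≡⟨ ℕ.*-assoc 16 2 N ⟨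
    N + 31 * N        ≡⟨ ℕ.+-comm N (31 * N) ⟩
    31 * N + N        ∎)
    where
    open ℕ.≤-Reasoning
    W = ∑ (queries n) (weight good?)
    e = length (filter good? (queries n))

  32^k*length-fewGood≤ : 32 ^ k * length (fewGood good? (queries n) k m) ≤ 2 ^ m * (31 ^ k * N ^ k)
  32^k*length-fewGood≤ = begin
    32 ^ k * length few           ≡⟨ ≡.cong (_* length few) (^-distrib-* 16 2 k) ⟩
    16 ^ k * 2 ^ k * length few   ≡⟨ ℕ.*-assoc (16 ^ k) (2 ^ k) _ ⟩
    16 ^ k * (2 ^ k * length few) ≤⟨ ℕ.*-monoʳ-≤ (16 ^ k) (length-fewGood good? (queries n) k m) ⟩
    16 ^ k * (2 ^ m * W ^ k)      ≡⟨ ℕ.*-assoc (16 ^ k) (2 ^ m) (W ^ k) ⟨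
    16 ^ k * 2 ^ m * W ^ k        ≡⟨ ≡.cong (_* W ^ k) (ℕ.*-comm (16 ^ k) (2 ^ m)) ⟩
    2 ^ m * 16 ^ k * W ^ k        ≡⟨ ℕ.*-assoc (2 ^ m) (16 ^ k) (W ^ k) ⟩
    2 ^ m * (16 ^ k * W ^ k)      ≡⟨ ≡.cong (2 ^ m *_) (^-distrib-* 16 W k) ⟨
    2 ^ m * (16 * W) ^ k          ≤⟨ ℕ.*-monoʳ-≤ (2 ^ m) (ℕ.^-monoˡ-≤ k 16*∑weight≤31*N) ⟩
    2 ^ m * (31 * N) ^ k          ≡⟨ ≡.cong (2 ^ m *_) (^-distrib-* 31 N k) ⟩
    2 ^ m * (31 ^ k * N ^ k)      ∎
    where
    open ℕ.≤-Reasoning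
    few = fewGood good? (queries n) k m
    W = ∑ (queries n) (weight good?)

module _ {n : ℕ} (k : ℕ) (X : Dataset n) {Y Y′ : Dataset n} (Y≗Y′ : ∀ i j → Y i j ≡ Y′ i j) where

  Bad-cong : Bad n k X Y → Bad n k X Y′
  Bad-cong = ≡.subst (λ h → ℤ.+ (128 * n ^ 6) ℤ.< ℤ.+ k ℤ.* h ℤ.^ 2)
    (IntegerSums.sumFin-cong n λ i → IntegerSums.sumFin-cong n λ j →
      ≡.cong (λ b → ℤ.+ ℤ.∣ bit (X i j) ℤ.- bit b ∣) (Y≗Y′ i j))

  Catches-cong : ∀ qs → Catches n k X qs Y → Catches n k X qs Y′
  Catches-cong qs (S , large , exceeds) = S , large , λ t t∈ →
    ≡.subst (λ d → ℤ.+ (8 * n ^ 6) ℤ.< ℤ.+ k ℤ.* d ℤ.^ 4) (dotDiff-cong (lookup qs t)) (exceeds t t∈)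
    where
    dotDiff-cong : ∀ q → dotDiff q X Y ≡ dotDiff q X Y′
    dotDiff-cong (A , B) = IntegerSums.sumFin-cong n λ i → IntegerSums.sumFin-cong n λ j →
      ≡.cong (λ b → sgn (lookup A i) ℤ.* sgn (lookup B j) ℤ.* (bit (X i j) ℤ.- bit b)) (Y≗Y′ i j)

-- Dataset n is a function type, so datasets are enumerated as nested vectors and read back by toDataset.
toDataset : ∀ {n} → Vec (Vec Bool n) n → Dataset n
toDataset V i j = lookup (lookup V i) j

toDataset-tabulate : ∀ {n} (Y : Dataset n) i j → Y i j ≡ toDataset (tabulate (tabulate ∘ Y)) i j
toDataset-tabulate Y i j = ≡.sym (≡.trans (≡.cong (λ r → lookup r j) (Vec.lookup∘tabulate (tabulate ∘ Y) i))
                                          (Vec.lookup∘tabulate (Y i) j))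

datasets : ∀ n → List (Vec (Vec Bool n) n)
datasets n = vecsOver (cube n) n

length-concatMap-filter-≤ : ∀ {A B : Set} {P : A → Set} (P? : Decidable P) (f : A → List B) c b xs →
  (∀ x → P x → c * length (f x) ≤ b) → c * length (concatMap f (filter P? xs)) ≤ length xs * b
length-concatMap-filter-≤ P? f c b []       bound = ℕ.≤-reflexive (ℕ.*-zeroʳ c)
length-concatMap-filter-≤ P? f c b (x ∷ xs) bound with P? x
... | no _   = ℕ.m≤n⇒m≤o+n b (length-concatMap-filter-≤ P? f c b xs bound)
... | yes px = begin
  c * length (f x ++ rest)          ≡⟨ ≡.cong (c *_) (List.length-++ (f x)) ⟩
  c * (length (f x) + length rest)  ≡⟨ ℕ.*-distribˡ-+ c (length (f x)) _ ⟩
  c * length (f x) + c * length rest ≤⟨ ℕ.+-mono-≤ (bound x px) (length-concatMap-filter-≤ P? f c b xs bound) ⟩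
  b + length xs * b                 ∎
  where
  open ℕ.≤-Reasoning
  rest = concatMap f (filter P? xs)

module Failures {n : ℕ} (k : ℕ) (X : Dataset n) where

  bad? : Decidable (Bad n k X ∘ toDataset)
  bad? V = ℤ.+ (128 * n ^ 6) ℤ.<? ℤ.+ k ℤ.* hamming X (toDataset V) ℤ.^ 2

  uncaught : Vec (Vec Bool n) n → List (Queries n k)
  uncaught V = fewGood (OneDataset.good? k X (toDataset V)) (queries n) k (4 * n ^ 2)

  failures : List (Queries n k)
  failures = concatMap uncaught (filter bad? (datasets n))

  fails⇒∈failures : ∀ qs → Fails n k X qs → qs ∈ₗ failures
  fails⇒∈failures qs (Y , badY , uncaughtY) = ∈-concat⁺′
    (∈-filter⁺ (λ qs → goodCount (OneDataset.good? k X Y′) qs ℕ.≤? 4 * n ^ 2)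
      (∈-vecsOver (queries n) ∈-queries qs) (OneDataset.uncaught⇒fewGood k X Y′ bad qs uncaught′))
    (∈-map⁺ uncaught (∈-filter⁺ bad? (∈-vecsOver (cube n) ∈-cube V) bad))
    where
    V = tabulate (tabulate ∘ Y)
    Y′ = toDataset V
    bad : Bad n k X Y′
    bad = Bad-cong k X (toDataset-tabulate Y) badY
    uncaught′ : ¬ Catches n k X qs Y′
    uncaught′ = uncaughtY ∘ Catches-cong k X (λ i j → ≡.sym (toDataset-tabulate Y i j)) qs

  32^k*length-failures≤ : 32 ^ k * length failures ≤ (2 ^ n) ^ n * (2 ^ (4 * n ^ 2) * (31 ^ k * length (queries n) ^ k))
  32^k*length-failures≤ = begin
    32 ^ k * length failures             ≤⟨ length-concatMap-filter-≤ bad? uncaught (32 ^ k) B (datasets n)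
                                              (λ V → 32^k*length-fewGood≤ k X (toDataset V)) ⟩
    length (datasets n) * B              ≡⟨ ≡.cong (_* B) (length-vecsOver (cube n) n) ⟩
    length (cube n) ^ n * B              ≡⟨ ≡.cong (λ l → l ^ n * B) (length-cube n) ⟩
    (2 ^ n) ^ n * B                      ∎
    where
    open ℕ.≤-Reasoning
    B = 2 ^ (4 * n ^ 2) * (31 ^ k * length (queries n) ^ k)

  6*length-failures≤ : 2 ≤ n → 128 * n ^ 2 < k → 6 * length failures ≤ 2 ^ (2 * n * k)
  6*length-failures≤ 2≤n 128n²<k = ℕ.*-cancelˡ-≤ (32 ^ k) {{ℕ.m^n≢0 32 k}} (begin
    32 ^ k * (6 * length failures)                         ≡⟨ swap (32 ^ k) 6 (length failures) ⟩
    6 * (32 ^ k * length failures)                         ≤⟨ ℕ.*-monoʳ-≤ 6 32^k*length-failures≤ ⟩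
    6 * ((2 ^ n) ^ n * (2 ^ (4 * x) * (31 ^ k * N ^ k)))   ≡⟨ regroup 6 ((2 ^ n) ^ n) (2 ^ (4 * x)) (31 ^ k) (N ^ k) ⟩
    6 * ((2 ^ n) ^ n * 2 ^ (4 * x)) * 31 ^ k * N ^ k       ≡⟨ ≡.cong (λ t → 6 * t * 31 ^ k * N ^ k) 2^n^n*2^4x≡32^x ⟩
    6 * 32 ^ x * 31 ^ k * N ^ k
      ≤⟨ ℕ.*-monoˡ-≤ (N ^ k) (6*32^x*31^k≤32^k x k (ℕ.^-monoˡ-≤ 2 2≤n) (ℕ.<⇒≤ 128n²<k)) ⟩
    32 ^ k * N ^ k                                         ≡⟨ ≡.cong (32 ^ k *_) N^k≡2^2nk ⟩
    32 ^ k * 2 ^ (2 * n * k)                               ∎)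
    where
    open ℕ.≤-Reasoning
    open import Data.Nat.Tactic.RingSolver using (solve-∀)
    x = n ^ 2
    N = length (queries n)
    swap : ∀ a b c → a * (b * c) ≡ b * (a * c)
    swap = solve-∀
    regroup : ∀ a b c d e → a * (b * (c * (d * e))) ≡ a * (b * c) * d * e
    regroup = solve-∀
    n*n≡x : n * n ≡ x
    n*n≡x = ≡.cong (n *_) (≡.sym (ℕ.*-identityʳ n))
    2^n^n*2^4x≡32^x : (2 ^ n) ^ n * 2 ^ (4 * x) ≡ 32 ^ x
    2^n^n*2^4x≡32^x = begin-equality
      (2 ^ n) ^ n * 2 ^ (4 * x) ≡⟨ ≡.cong (_* 2 ^ (4 * x)) (≡.trans (ℕ.^-*-assoc 2 n n) (≡.cong (2 ^_) n*n≡x)) ⟩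
      2 ^ x * 2 ^ (4 * x)       ≡⟨ ℕ.^-distribˡ-+-* 2 x (4 * x) ⟨
      2 ^ (5 * x)               ≡⟨ ℕ.^-*-assoc 2 5 x ⟨
      32 ^ x                    ∎
    N^k≡2^2nk : N ^ k ≡ 2 ^ (2 * n * k)
    N^k≡2^2nk = begin-equality
      N ^ k                     ≡⟨ ≡.cong (_^ k) (length-queries n) ⟩
      (2 ^ n * 2 ^ n) ^ k       ≡⟨ ≡.cong (_^ k) (ℕ.^-distribˡ-+-* 2 n n) ⟨
      (2 ^ (n + n)) ^ k         ≡⟨ ≡.cong (λ e → (2 ^ (n + e)) ^ k) (ℕ.+-identityʳ n) ⟨
      (2 ^ (2 * n)) ^ k         ≡⟨ ℕ.^-*-assoc 2 (2 * n) k ⟩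
      2 ^ (2 * n * k)           ∎

no-failures-1×1 : ∀ k → 128 < k → (X : Dataset 1) (qs : Queries 1 k) → ¬ Fails 1 k X qs
no-failures-1×1 k 128<k X qs (Y , bad , uncaught) = ℕ.<⇒≱ 128<k (begin
  k                                     ≡⟨ goodCount-all (OneDataset.good? k X Y) (OneByOne.all-good k X Y) qs ⟨
  goodCount (OneDataset.good? k X Y) qs ≤⟨ OneDataset.uncaught⇒fewGood k X Y bad qs uncaught ⟩
  4                                     ≤⟨ ℕ.≤ᵇ⇒≤ 4 128 _ ⟩
  128                                   ∎)
  where open ℕ.≤-Reasoning

lemma3p8 : (n k : ℕ) → 1 ≤ n → 128 * n ^ 2 < k → (X : Dataset n) →
    ProbAtMostSixth n k (Fails n k X)
lemma3p8 ℕ.zero                 k () 128n²<k X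
lemma3p8 (ℕ.suc ℕ.zero)         k _  128<k   X = [] , (λ qs fails → contradiction fails (no-failures-1×1 k 128<k X qs)) , z≤n
lemma3p8 (ℕ.suc (ℕ.suc _))      k _  128n²<k X =
  failures , fails⇒∈failures , 6*length-failures≤ (s≤s (s≤s z≤n)) 128n²<k
  where open Failures k X
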